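{- For every infinite sequence $\mathbf f\in\{ -1,1\}^{\omega}$, the number of distinct factors of length $n$ of the run-length sequence $R_{\mathbf f}$ equals $4n+4$ for all $n\ge 6$.
   Context: For a finite sequence $\mathbf f$ over $\{ -1,1\}$ define $P_\epsilon=\epsilon$ (empty) and $P_{\mathbf f a}=P_{\mathbf f}\ a\ (-P_{\mathbf f}^R)$ for $a\in\{ -1,1\}$, where $-x$ negates every entry and $x^R$ is reversal. For an infinite $\mathbf f=f_0f_1\cdots$, $P_{\mathbf f}$ is the unique infinite sequence having every $P_{f_0\cdots f_n}$ as a prefix. A run is a maximal block of consecutive identical entries; the run-length sequence $R_{\mathbf f}$ is the infinite sequence of lengths of the runs of $P_{\mathbf f}$ from left to right. A factor is a contiguous block. -}

module Defs where

open import Data.Nat using (ℕ; zero; suc; _+_; _*_; _∸_; _<_; _≤_)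
open import Data.List using (List; []; _∷_; _++_; map; reverse; length)
open import Data.List.Relation.Unary.Unique.Propositional using (Unique)
open import Data.List.Membership.Propositional using (_∈_)
open import Data.Vec using (Vec; lookup)
open import Data.Fin using (Fin; toℕ)
open import Data.Product using (Σ; ∃; _×_)
open import Function.Bundles using (_⇔_)
open import Relation.Binary.PropositionalEquality using (_≡_; _≢_)

data PM : Set where
  m1 p1 : PM

neg : PM → PM
neg m1 = p1
neg p1 = m1

Seq : Set → Set
Seq A = ℕ → A

-- Pfin f n = P_{f_0 ⋯ f_{n-1}}  (Pfin f 0 = P_ε = ε),
-- P_{𝐟 a} = P_𝐟 a (−P_𝐟^R).
Pfin : Seq PM → ℕ → List PM
Pfin f zero    = []
Pfin f (suc n) = Pfin f n ++ (f n ∷ map neg (reverse (Pfin f n)))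

nthOr : {A : Set} → A → List A → ℕ → A
nthOr d []       k       = d
nthOr d (x ∷ xs) zero    = x
nthOr d (x ∷ xs) (suc k) = nthOr d xs k

-- The infinite paperfolding sequence P_𝐟: its k-th entry is the k-th entry
-- of the prefix P_{f_0 ⋯ f_k} (which has length 2^(k+1) - 1 > k).
Pinf : Seq PM → Seq PM
Pinf f k = nthOr p1 (Pfin f (suc k)) k

-- R is the run-length sequence of the infinite sequence s:
-- b enumerates, in strictly increasing order, exactly the positions i that
-- end a run (s i ≠ s (i+1)); the run lengths are b 0 + 1 and b (k+1) − b k.
IsRunLengthSeq : {A : Set} → Seq A → Seq ℕ → Set
IsRunLengthSeq s R =
  Σ (ℕ → ℕ) λ b →
    (∀ k → b k < b (suc k)) ×
    (∀ i → (s i ≢ s (suc i)) ⇔ (∃ λ k → b k ≡ i)) ×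
    (R zero ≡ suc (b zero)) ×
    (∀ k → R (suc k) ≡ b (suc k) ∸ b k)

IsFactor : {A : Set} {n : ℕ} → Seq A → Vec A n → Set
IsFactor {n = n} s w = ∃ λ i → ∀ (j : Fin n) → s (i + toℕ j) ≡ lookup w j

FactorCount : {A : Set} → Seq A → ℕ → ℕ → Set
FactorCount {A} s n c =
  Σ (List (Vec A n)) λ L →
    Unique L × (length L ≡ c) × (∀ w → (w ∈ L) ⇔ IsFactor s w)

-- P_f interleaves the alternating sequence f₀, −f₀, f₀, … (even positions) with P_{f₁f₂⋯}
-- (odd positions). Hence each block {2k, 2k+1} contains exactly one run boundary, at 2k+1
-- precisely when d_k = P_f(2k)·P_f(2k+1) is +1, and d is itself a paperfolding sequence.
-- The run lengths R₀ = 1 + [d₀ = 1] and R_{k+1} = 2 + [d_{k+1} = 1] − [d_k = 1] are thus a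
-- sliding block code of +1 d₀ d₁ ⋯, injective on factors of length ≥ 4 because no
-- paperfolding sequence has a factor xyxy; and +1 followed by a prefix of d occurs in d.
-- So the factors of R of length n correspond to the factors of d of length n + 1. Counting
-- factors of a paperfolding sequence together with the parity of an occurrence gives
-- 4⌊m/2⌋ + 4⌈m/2⌉ = 4m for every m ≥ 1 by the interleaving, and for m ≥ 7 the parity of an
-- occurrence is determined by the factor, so there are 4(n + 1) of them.

module Submission where

open import Defs
open import Data.Nat using (ℕ; _+_; _*_; _≤_)
open import Data.Product using (Σ; _×_)

open import Data.Bool using (Bool; true; false)
open import Data.Empty using (⊥; ⊥-elim)
open import Data.Fin using (Fin; toℕ; fromℕ<) renaming (zero to fzero; suc to fsuc)
open import Data.Fin.Properties using (toℕ-fromℕ<)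
open import Data.List using (List; []; _∷_; _++_; map; reverse; length)
open import Data.List.Properties
  using (length-++; length-map; length-reverse; map-++; reverse-++; reverse-map; map-∘; map-cong; ++-assoc; ++-identityʳ)
open import Data.List.Membership.Propositional using (_∈_)
open import Data.List.Membership.Propositional.Properties using (∈-map⁺; ∈-map⁻; ∈-++⁺ˡ; ∈-++⁺ʳ; ∈-++⁻)
open import Data.List.Relation.Unary.All as All using ([]; _∷_)
import Data.List.Relation.Unary.All.Properties as Allₚ
open import Data.List.Relation.Unary.AllPairs using ([]; _∷_)
open import Data.List.Relation.Unary.Any using (here; there)
open import Data.List.Relation.Unary.Unique.Propositional using (Unique)
open import Data.List.Relation.Unary.Unique.Propositional.Properties using (++⁺)
open import Data.Nat using (zero; suc; _∸_; _<_; z≤n; s≤s; ⌊_/2⌋; ⌈_/2⌉; _≤′_; ≤′-refl; ≤′-step)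
open import Data.Nat.Induction using (<-rec)
open import Data.Nat.Properties
open import Data.Nat.Tactic.RingSolver using (solve-∀)
open import Data.Product using (∃; _,_; proj₁; proj₂)
open import Data.Sum using (_⊎_; inj₁; inj₂; [_,_])
open import Data.Vec using (Vec; []; _∷_; lookup; tabulate)
open import Data.Vec.Properties using (∷-injectiveˡ; ∷-injectiveʳ; tabulate∘lookup; tabulate-cong)
open import Function using (_∘_; case_of_)
open import Function.Bundles using (_⇔_; mk⇔; Equivalence)
import Function.Properties.Equivalence as ⇔
open import Relation.Binary.Definitions using (DecidableEquality)
open import Relation.Binary.PropositionalEquality using (_≡_; _≢_; refl; sym; trans; cong; cong₂; subst; subst₂; module ≡-Reasoning)
open import Relation.Nullary using (yes; no)

open Equivalence using (to; from)

neg-involutive : ∀ x → neg (neg x) ≡ x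
neg-involutive m1 = refl
neg-involutive p1 = refl

neg-injective : ∀ {x y} → neg x ≡ neg y → x ≡ y
neg-injective {x} {y} e = trans (sym (neg-involutive x)) (trans (cong neg e) (neg-involutive y))

neg≢ : ∀ x → neg x ≢ x
neg≢ m1 ()
neg≢ p1 ()

_≟ₚ_ : DecidableEquality PM
m1 ≟ₚ m1 = yes refl
m1 ≟ₚ p1 = no λ ()
p1 ≟ₚ m1 = no λ ()
p1 ≟ₚ p1 = yes refl

alt : PM → ℕ → PM
alt x zero    = x
alt x (suc j) = neg (alt x j)

alt-neg : ∀ x j → alt (neg x) j ≡ neg (alt x j)
alt-neg x zero    = refl
alt-neg x (suc j) = cong neg (alt-neg x j)

alt-alt : ∀ x m n → alt (alt x m) n ≡ alt x (n + m)
alt-alt x m zero    = refl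
alt-alt x m (suc n) = cong neg (alt-alt x m n)

alt-double : ∀ x j → alt x (j + j) ≡ x
alt-double x zero    = refl
alt-double x (suc j) rewrite +-suc j j = trans (neg-involutive (alt x (j + j))) (alt-double x j)

alt-hits : ∀ x y → ∃ λ j → alt x j ≡ y
alt-hits m1 m1 = 0 , refl
alt-hits m1 p1 = 1 , refl
alt-hits p1 m1 = 1 , refl
alt-hits p1 p1 = 0 , refl

_·_ : PM → PM → PM
p1 · y = y
m1 · y = neg y

·-neg : ∀ x y → x · neg y ≡ neg (x · y)
·-neg p1 y = refl
·-neg m1 y = refl

·-alt : ∀ x y j → x · alt y j ≡ alt (x · y) j
·-alt x y zero    = refl
·-alt x y (suc j) = trans (·-neg x (alt y j)) (cong neg (·-alt x y j))

isP1 : PM → Bool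
isP1 p1 = true
isP1 m1 = false

≢⇔isP1-·≡false : ∀ x y → (x ≢ y) ⇔ (isP1 (x · y) ≡ false)
≢⇔isP1-·≡false m1 m1 = mk⇔ (λ x≢y → ⊥-elim (x≢y refl)) λ ()
≢⇔isP1-·≡false m1 p1 = mk⇔ (λ _ → refl) λ _ ()
≢⇔isP1-·≡false p1 m1 = mk⇔ (λ _ → refl) λ _ ()
≢⇔isP1-·≡false p1 p1 = mk⇔ (λ x≢y → ⊥-elim (x≢y refl)) λ ()

≢neg⇔isP1-·≡true : ∀ x y → (y ≢ neg x) ⇔ (isP1 (x · y) ≡ true)
≢neg⇔isP1-·≡true m1 m1 = mk⇔ (λ _ → refl) λ _ ()
≢neg⇔isP1-·≡true m1 p1 = mk⇔ (λ y≢ → ⊥-elim (y≢ refl)) λ ()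
≢neg⇔isP1-·≡true p1 m1 = mk⇔ (λ y≢ → ⊥-elim (y≢ refl)) λ ()
≢neg⇔isP1-·≡true p1 p1 = mk⇔ (λ _ → refl) λ _ ()

pos : Bool → ℕ → ℕ
pos false j = j + j
pos true  j = suc (j + j)

suc-suc-double : ∀ j → suc (suc (j + j)) ≡ suc j + suc j
suc-suc-double j = cong suc (sym (+-suc j j))

data Parity : ℕ → Set where
  at : ∀ b j → Parity (pos b j)

parity : ∀ i → Parity i
parity zero = at false zero
parity (suc i) with parity i
... | at false j = at true j
... | at true  j = subst Parity (sym (suc-suc-double j)) (at false (suc j))

⌊pos/2⌋≡ : ∀ b j → ⌊ pos b j /2⌋ ≡ j
⌊pos/2⌋≡ false j = sym (n≡⌊n+n/2⌋ j)
⌊pos/2⌋≡ true  j = sym (n≡⌈n+n/2⌉ j)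

pos-injective : ∀ {b b′ j j′} → pos b j ≡ pos b′ j′ → b ≡ b′ × j ≡ j′
pos-injective {b} {b′} {j} {j′} e
  with trans (sym (⌊pos/2⌋≡ b j)) (trans (cong ⌊_/2⌋ e) (⌊pos/2⌋≡ b′ j′))
pos-injective {false} {false} e | refl = refl , refl
pos-injective {true}  {true}  e | refl = refl , refl
pos-injective {false} {true}  e | refl = ⊥-elim (1+n≢n (sym e))
pos-injective {true}  {false} e | refl = ⊥-elim (1+n≢n e)

pos<pos-suc : ∀ b b′ j → pos b j < pos b′ (suc j)
pos<pos-suc false false j = s≤s (+-monoʳ-≤ j (n≤1+n j))
pos<pos-suc false true  j = m≤n⇒m≤1+n (s≤s (+-monoʳ-≤ j (n≤1+n j)))
pos<pos-suc true  false j = s≤s (≤-reflexive (sym (+-suc j j)))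
pos<pos-suc true  true  j = s≤s (s≤s (+-monoʳ-≤ j (n≤1+n j)))

alt-pos : ∀ x b j → alt x (pos b j) ≡ alt x (pos b 0)
alt-pos x false j = alt-double x j
alt-pos x true  j = cong neg (alt-double x j)

alt-pos-injective : ∀ x {b b′} → alt x (pos b 0) ≡ alt x (pos b′ 0) → b ≡ b′
alt-pos-injective x {false} {false} _ = refl
alt-pos-injective x {false} {true}  e = ⊥-elim (neg≢ x (sym e))
alt-pos-injective x {true}  {false} e = ⊥-elim (neg≢ x e)
alt-pos-injective x {true}  {true}  _ = refl

tail : {A : Set} → Seq A → Seq A
tail s k = s (suc k)

negRev : List PM → List PM
negRev xs = map neg (reverse xs)

negRev-++ : ∀ xs ys → negRev (xs ++ ys) ≡ negRev ys ++ negRev xs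
negRev-++ xs ys rewrite reverse-++ xs ys = map-++ neg (reverse ys) (reverse xs)

length-negRev : ∀ xs → length (negRev xs) ≡ length xs
length-negRev xs = trans (length-map neg (reverse xs)) (length-reverse xs)

interleave : PM → List PM → List PM
interleave x []       = x ∷ []
interleave x (y ∷ ys) = x ∷ y ∷ interleave (neg x) ys

interleave-++ : ∀ x xs y ys →
  interleave x (xs ++ y ∷ ys) ≡ interleave x xs ++ y ∷ interleave (alt x (suc (length xs))) ys
interleave-++ x []       y ys = refl
interleave-++ x (z ∷ xs) y ys = cong (λ l → x ∷ z ∷ l) (begin
  interleave (neg x) (xs ++ y ∷ ys)
    ≡⟨ interleave-++ (neg x) xs y ys ⟩
  interleave (neg x) xs ++ y ∷ interleave (alt (neg x) (suc (length xs))) ys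
    ≡⟨ cong (λ c → interleave (neg x) xs ++ y ∷ interleave c ys) (cong neg (alt-neg x (length xs))) ⟩
  interleave (neg x) xs ++ y ∷ interleave (alt x (suc (suc (length xs)))) ys ∎)
  where open ≡-Reasoning

negRev-interleave : ∀ x ys → negRev (interleave x ys) ≡ interleave (alt (neg x) (length ys)) (negRev ys)
negRev-interleave x []       = refl
negRev-interleave x (y ∷ ys) = begin
  negRev (x ∷ y ∷ interleave (neg x) ys)
    ≡⟨ negRev-++ (x ∷ y ∷ []) (interleave (neg x) ys) ⟩
  negRev (interleave (neg x) ys) ++ neg y ∷ neg x ∷ []
    ≡⟨ cong (_++ neg y ∷ neg x ∷ []) (negRev-interleave (neg x) ys) ⟩
  interleave z (negRev ys) ++ neg y ∷ neg x ∷ []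
    ≡⟨ cong (λ w → interleave z (negRev ys) ++ neg y ∷ w ∷ []) (sym last) ⟩
  interleave z (negRev ys) ++ neg y ∷ interleave (alt z (suc (length (negRev ys)))) []
    ≡⟨ sym (interleave-++ z (negRev ys) (neg y) []) ⟩
  interleave z (negRev ys ++ neg y ∷ [])
    ≡⟨ cong (interleave z) (sym (negRev-++ (y ∷ []) ys)) ⟩
  interleave z (negRev (y ∷ ys))
    ≡⟨ cong (λ c → interleave c (negRev (y ∷ ys))) (alt-neg (neg x) (length ys)) ⟩
  interleave (alt (neg x) (suc (length ys))) (negRev (y ∷ ys)) ∎
  where
  open ≡-Reasoning
  z = alt (neg (neg x)) (length ys)
  last : alt z (suc (length (negRev ys))) ≡ neg x
  last rewrite length-negRev ys | alt-alt (neg (neg x)) (length ys) (length ys)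
             | alt-double (neg (neg x)) (length ys) = cong neg (neg-involutive x)

Pfin-interleave : ∀ f n → Pfin f (suc n) ≡ interleave (f 0) (Pfin (tail f) n)
Pfin-interleave f zero    = refl
Pfin-interleave f (suc n) = begin
  Pfin f (suc n) ++ f (suc n) ∷ negRev (Pfin f (suc n))
    ≡⟨ cong (λ l → l ++ f (suc n) ∷ negRev l) (Pfin-interleave f n) ⟩
  interleave a P ++ f (suc n) ∷ negRev (interleave a P)
    ≡⟨ cong (λ l → interleave a P ++ f (suc n) ∷ l) (negRev-interleave a P) ⟩
  interleave a P ++ f (suc n) ∷ interleave (alt (neg a) (length P)) (negRev P)
    ≡⟨ cong (λ c → interleave a P ++ f (suc n) ∷ interleave c (negRev P)) (alt-neg a (length P)) ⟩
  interleave a P ++ f (suc n) ∷ interleave (alt a (suc (length P))) (negRev P)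
    ≡⟨ sym (interleave-++ a P (f (suc n)) (negRev P)) ⟩
  interleave a (P ++ f (suc n) ∷ negRev P) ∎
  where
  open ≡-Reasoning
  a = f 0
  P = Pfin (tail f) n

nthOr-++ˡ : ∀ {A : Set} (d : A) xs ys k → k < length xs → nthOr d (xs ++ ys) k ≡ nthOr d xs k
nthOr-++ˡ d (x ∷ xs) ys zero    _         = refl
nthOr-++ˡ d (x ∷ xs) ys (suc k) (s≤s k<n) = nthOr-++ˡ d xs ys k k<n

nthOr-default : ∀ {A : Set} (d d′ : A) xs k → k < length xs → nthOr d xs k ≡ nthOr d′ xs k
nthOr-default d d′ (x ∷ xs) zero    _         = refl
nthOr-default d d′ (x ∷ xs) (suc k) (s≤s k<n) = nthOr-default d d′ xs k k<n

nthOr-map : ∀ {A B : Set} (f : A → B) d xs k → nthOr (f d) (map f xs) k ≡ f (nthOr d xs k)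
nthOr-map f d []       k       = refl
nthOr-map f d (x ∷ xs) zero    = refl
nthOr-map f d (x ∷ xs) (suc k) = nthOr-map f d xs k

nthOr-interleave-even : ∀ d x ys j → j ≤ length ys → nthOr d (interleave x ys) (j + j) ≡ alt x j
nthOr-interleave-even d x []       zero    _ = refl
nthOr-interleave-even d x (y ∷ ys) zero    _ = refl
nthOr-interleave-even d x (y ∷ ys) (suc j) (s≤s j≤n) rewrite +-suc j j =
  trans (nthOr-interleave-even d (neg x) ys j j≤n) (alt-neg x j)

nthOr-interleave-odd : ∀ d x ys j → j < length ys → nthOr d (interleave x ys) (suc (j + j)) ≡ nthOr d ys j
nthOr-interleave-odd d x (y ∷ ys) zero    _ = refl
nthOr-interleave-odd d x (y ∷ ys) (suc j) (s≤s j<n) rewrite +-suc j j = nthOr-interleave-odd d (neg x) ys j j<n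

n≤length-Pfin : ∀ f n → n ≤ length (Pfin f n)
n≤length-Pfin f zero    = z≤n
n≤length-Pfin f (suc n) rewrite length-++ (Pfin f n) {f n ∷ negRev (Pfin f n)} =
  ≤-trans (s≤s (≤-trans (n≤length-Pfin f n) (m≤m+n _ _))) (≤-reflexive (sym (+-suc _ _)))

Pfin-prefix : ∀ f {n m} → n ≤′ m → ∃ λ ys → Pfin f m ≡ Pfin f n ++ ys
Pfin-prefix f ≤′-refl = [] , sym (++-identityʳ _)
Pfin-prefix f {n} (≤′-step {m} n≤m) with Pfin-prefix f n≤m
... | ys , e = ys ++ rest , trans (cong (_++ rest) e) (++-assoc (Pfin f n) ys rest)
  where rest = f m ∷ negRev (Pfin f m)

Pinf-from-Pfin : ∀ f {n} k → k < n → nthOr p1 (Pfin f n) k ≡ Pinf f k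
Pinf-from-Pfin f k k<n with Pfin-prefix f (≤⇒≤′ k<n)
... | ys , e rewrite e = nthOr-++ˡ p1 (Pfin f (suc k)) ys k (n≤length-Pfin f (suc k))

Pinf-even : ∀ f j → Pinf f (j + j) ≡ alt (f 0) j
Pinf-even f j rewrite Pfin-interleave f (j + j) =
  nthOr-interleave-even p1 (f 0) (Pfin (tail f) (j + j)) j (≤-trans (m≤m+n j j) (n≤length-Pfin (tail f) (j + j)))

Pinf-odd : ∀ f j → Pinf f (suc (j + j)) ≡ Pinf (tail f) j
Pinf-odd f j rewrite Pfin-interleave f (suc (j + j)) =
  trans (nthOr-interleave-odd p1 (f 0) (Pfin (tail f) (suc (j + j))) j
           (≤-trans j<2j+1 (n≤length-Pfin (tail f) (suc (j + j)))))
        (Pinf-from-Pfin (tail f) j j<2j+1)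
  where
  j<2j+1 : j < suc (j + j)
  j<2j+1 = s≤s (m≤m+n j j)

Pinf-even-suc : ∀ f j → Pinf f (suc (suc (j + j))) ≡ alt (f 0) (suc j)
Pinf-even-suc f j = trans (cong (Pinf f) (suc-suc-double j)) (Pinf-even f (suc j))

negRev-map-· : ∀ c xs → negRev (map (c ·_) xs) ≡ map (c ·_) (negRev xs)
negRev-map-· c xs = begin
  map neg (reverse (map (c ·_) xs))   ≡⟨ cong (map neg) (sym (reverse-map (c ·_) xs)) ⟩
  map neg (map (c ·_) (reverse xs))   ≡⟨ sym (map-∘ (reverse xs)) ⟩
  map (neg ∘ (c ·_)) (reverse xs)     ≡⟨ map-cong (λ x → sym (·-neg c x)) (reverse xs) ⟩
  map ((c ·_) ∘ neg) (reverse xs)     ≡⟨ map-∘ (reverse xs) ⟩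
  map (c ·_) (negRev xs)              ∎
  where open ≡-Reasoning

Pfin-scale : ∀ c h n → Pfin (λ k → c · h k) n ≡ map (c ·_) (Pfin h n)
Pfin-scale c h zero    = refl
Pfin-scale c h (suc n) rewrite Pfin-scale c h n | map-++ (c ·_) (Pfin h n) (h n ∷ negRev (Pfin h n)) =
  cong (λ l → map (c ·_) (Pfin h n) ++ c · h n ∷ l) (negRev-map-· c (Pfin h n))

Pinf-scale : ∀ c h i → Pinf (λ k → c · h k) i ≡ c · Pinf h i
Pinf-scale c h i rewrite Pfin-scale c h (suc i) =
  trans (nthOr-default p1 (c · p1) (map (c ·_) P) i (≤-trans (n≤length-Pfin h (suc i)) (≤-reflexive (sym (length-map (c ·_) P)))))
        (nthOr-map (c ·_) p1 P i)
  where P = Pfin h (suc i)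

Pinf-hits : ∀ g b y → ∃ λ j → Pinf g (pos b j) ≡ y
Pinf-hits g false y with alt-hits (g 0) y
... | j , e = j , trans (Pinf-even g j) e
Pinf-hits g true  y with alt-hits (g 1) y
... | j , e = j + j , trans (Pinf-odd g (j + j)) (trans (Pinf-even (tail g) j) e)

Pinf-no-period-2 : ∀ g q → Pinf g (suc (suc q)) ≡ Pinf g q → Pinf g (suc (suc (suc q))) ≡ Pinf g (suc q) → ⊥
Pinf-no-period-2 g q with parity q
... | at false j = λ e _ → neg≢ (alt (g 0) j) (trans (sym (Pinf-even-suc g j)) (trans e (Pinf-even g j)))
... | at true  j = λ _ e → neg≢ (alt (g 0) (suc j)) (trans (sym two-blocks-on) (trans e (Pinf-even-suc g j)))
  where
  two-blocks-on : Pinf g (suc (suc (suc (suc (j + j))))) ≡ alt (g 0) (suc (suc j))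
  two-blocks-on = trans (cong (λ i → Pinf g (suc i)) (cong suc (suc-suc-double j))) (Pinf-even-suc g (suc j))

window : {A : Set} → Seq A → ℕ → (m : ℕ) → Vec A m
window s i zero    = []
window s i (suc m) = s i ∷ window s (suc i) m

lookup-window : ∀ {A : Set} (s : Seq A) i {m} (k : Fin m) → lookup (window s i m) k ≡ s (i + toℕ k)
lookup-window s i fzero    = cong s (sym (+-identityʳ i))
lookup-window s i (fsuc k) = trans (lookup-window s (suc i) k) (cong s (sym (+-suc i (toℕ k))))

window-≡ : ∀ {A : Set} (s : Seq A) i {n} (w : Vec A n) → (∀ k → s (i + toℕ k) ≡ lookup w k) → window s i n ≡ w
window-≡ s i {n} w agree = begin
  window s i n                      ≡⟨ sym (tabulate∘lookup (window s i n)) ⟩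
  tabulate (lookup (window s i n))  ≡⟨ tabulate-cong (λ k → trans (lookup-window s i k) (agree k)) ⟩
  tabulate (lookup w)               ≡⟨ tabulate∘lookup w ⟩
  w                                 ∎
  where open ≡-Reasoning

IsFactor⇔window : ∀ {A : Set} (s : Seq A) {n} (w : Vec A n) → IsFactor s w ⇔ (∃ λ i → window s i n ≡ w)
IsFactor⇔window s w = mk⇔ (λ (i , agree) → i , window-≡ s i w agree)
                          (λ { (i , refl) → i , λ k → sym (lookup-window s i k) })

window-agree : ∀ {A : Set} (s : Seq A) i i′ m k → window s i m ≡ window s i′ m → k < m → s (i + k) ≡ s (i′ + k)
window-agree s i i′ m k e k<m = begin
  s (i + k)            ≡⟨ cong (λ l → s (i + l)) (sym (toℕ-fromℕ< k<m)) ⟩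
  s (i + toℕ k′)       ≡⟨ sym (lookup-window s i k′) ⟩
  lookup (window s i m) k′ ≡⟨ cong (λ w → lookup w k′) e ⟩
  lookup (window s i′ m) k′ ≡⟨ lookup-window s i′ k′ ⟩
  s (i′ + toℕ k′)      ≡⟨ cong (λ l → s (i′ + l)) (toℕ-fromℕ< k<m) ⟩
  s (i′ + k)           ∎
  where
  open ≡-Reasoning
  k′ = fromℕ< k<m

weaveAtEven : ∀ m → PM → Vec PM ⌊ m /2⌋ → Vec PM m
weaveAtOdd  : ∀ m → PM → Vec PM ⌈ m /2⌉ → Vec PM m
weaveAtEven zero    x []      = []
weaveAtEven (suc m) x u       = x ∷ weaveAtOdd m (neg x) u
weaveAtOdd  zero    x []      = []
weaveAtOdd  (suc m) x (y ∷ u) = y ∷ weaveAtEven m x u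

weaveAtEven-injective : ∀ m {x x′ u u′} → weaveAtEven m x u ≡ weaveAtEven m x′ u′ → u ≡ u′
weaveAtOdd-injective  : ∀ m {x x′ u u′} → weaveAtOdd m x u ≡ weaveAtOdd m x′ u′ → u ≡ u′
weaveAtEven-injective zero    {u = []} {[]} _ = refl
weaveAtEven-injective (suc m) e = weaveAtOdd-injective m (∷-injectiveʳ e)
weaveAtOdd-injective  zero    {u = []} {[]} _ = refl
weaveAtOdd-injective  (suc m) {u = _ ∷ _} {_ ∷ _} e =
  cong₂ _∷_ (∷-injectiveˡ e) (weaveAtEven-injective m (∷-injectiveʳ e))

window-even : ∀ g j m →
  window (Pinf g) (j + j) m ≡ weaveAtEven m (alt (g 0) j) (window (Pinf (tail g)) j ⌊ m /2⌋)
window-odd : ∀ g j m →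
  window (Pinf g) (suc (j + j)) m ≡ weaveAtOdd m (alt (g 0) (suc j)) (window (Pinf (tail g)) j ⌈ m /2⌉)
window-even g j zero    = refl
window-even g j (suc m) = cong₂ _∷_ (Pinf-even g j) (window-odd g j m)
window-odd  g j zero    = refl
window-odd  g j (suc m) = cong₂ _∷_ (Pinf-odd g j)
  (trans (cong (λ i → window (Pinf g) i m) (suc-suc-double j)) (window-even g (suc j) m))

Unique-map-injectiveOn : ∀ {A B : Set} {h : A → B} {xs : List A} →
  (∀ {x y} → x ∈ xs → y ∈ xs → h x ≡ h y → x ≡ y) → Unique xs → Unique (map h xs)
Unique-map-injectiveOn inj []            = []
Unique-map-injectiveOn inj (x∉xs ∷ uxs) =
  Allₚ.map⁺ (All.tabulate λ y∈ → All.lookup x∉xs y∈ ∘ inj (here refl) (there y∈))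
  ∷ Unique-map-injectiveOn (λ x∈ y∈ → inj (there x∈) (there y∈)) uxs

Count : {A : Set} → (A → Set) → ℕ → Set
Count {A} P c = Σ (List A) λ L → Unique L × (length L ≡ c) × (∀ x → (x ∈ L) ⇔ P x)

Image : {A B : Set} → (A → B) → (A → Set) → B → Set
Image h P y = ∃ λ x → P x × h x ≡ y

module _ {A : Set} {P : A → Set} where

  Count-cong : ∀ {Q : A → Set} {c} → (∀ x → P x ⇔ Q x) → Count P c → Count Q c
  Count-cong P⇔Q (L , u , len , mem) = L , u , len , λ x → ⇔.trans (mem x) (P⇔Q x)

  Count-image : ∀ {B : Set} {h : A → B} {c} → (∀ {x y} → P x → P y → h x ≡ h y → x ≡ y) →
    Count P c → Count (Image h P) c
  Count-image {h = h} inj (L , u , len , mem) =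
    map h L ,
    Unique-map-injectiveOn (λ x∈ y∈ → inj (to (mem _) x∈) (to (mem _) y∈)) u ,
    trans (length-map h L) len ,
    λ y → mk⇔ (image y) λ { (x , Px , refl) → ∈-map⁺ h (from (mem x) Px) }
    where
    image : ∀ y → y ∈ map h L → Image h P y
    image y y∈ with ∈-map⁻ h y∈
    ... | x , x∈ , refl = x , to (mem x) x∈ , refl

  Count-⊎ : ∀ {Q : A → Set} {a b} → (∀ {x} → P x → Q x → ⊥) →
    Count P a → Count Q b → Count (λ x → P x ⊎ Q x) (a + b)
  Count-⊎ disjoint (L , u , len , mem) (L′ , u′ , len′ , mem′) =
    L ++ L′ ,
    ++⁺ u u′ (λ (x∈ , x∈′) → disjoint (to (mem _) x∈) (to (mem′ _) x∈′)) ,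
    trans (length-++ L) (cong₂ _+_ len len′) ,
    λ x → mk⇔ (λ x∈ → [ inj₁ ∘ to (mem x) , inj₂ ∘ to (mem′ x) ] (∈-++⁻ L x∈))
              [ ∈-++⁺ˡ ∘ from (mem x) , ∈-++⁺ʳ L ∘ from (mem′ x) ]

ParityFactor : {A : Set} → Seq A → (m : ℕ) → Vec A m × Bool → Set
ParityFactor s m (w , b) = ∃ λ j → window s (pos b j) m ≡ w

parityFactorCount-1 : ∀ g → Count (ParityFactor (Pinf g) 1) 4
parityFactorCount-1 g = singletons , distinct , refl , λ x → mk⇔ (λ _ → occurs x) listed
  where
  singletons : List (Vec PM 1 × Bool)
  singletons = (p1 ∷ [] , false) ∷ (m1 ∷ [] , false) ∷ (p1 ∷ [] , true) ∷ (m1 ∷ [] , true) ∷ []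
  distinct : Unique singletons
  distinct = ((λ ()) ∷ (λ ()) ∷ (λ ()) ∷ []) ∷ ((λ ()) ∷ (λ ()) ∷ []) ∷ ((λ ()) ∷ []) ∷ [] ∷ []
  occurs : ∀ x → ParityFactor (Pinf g) 1 x
  occurs (y ∷ [] , b) with Pinf-hits g b y
  ... | j , e = j , cong (_∷ []) e
  listed : ∀ {x} → ParityFactor (Pinf g) 1 x → x ∈ singletons
  listed {p1 ∷ [] , false} _ = here refl
  listed {m1 ∷ [] , false} _ = there (here refl)
  listed {p1 ∷ [] , true}  _ = there (there (here refl))
  listed {m1 ∷ [] , true}  _ = there (there (there (here refl)))

module ParityStep (g : Seq PM) (m : ℕ) where

  liftEven : Vec PM ⌊ m /2⌋ × Bool → Vec PM m × Bool
  liftEven (u , b) = weaveAtEven m (alt (g 0) (pos b 0)) u , false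

  liftOdd : Vec PM ⌈ m /2⌉ × Bool → Vec PM m × Bool
  liftOdd (u , b) = weaveAtOdd m (alt (g 0) (suc (pos b 0))) u , true

  window-liftEven : ∀ b j →
    liftEven (window (Pinf (tail g)) (pos b j) ⌊ m /2⌋ , b) ≡ (window (Pinf g) (pos false (pos b j)) m , false)
  window-liftEven b j = cong (_, false) (sym (trans (window-even g (pos b j) m)
    (cong (λ x → weaveAtEven m x (window (Pinf (tail g)) (pos b j) ⌊ m /2⌋)) (alt-pos (g 0) b j))))

  window-liftOdd : ∀ b j →
    liftOdd (window (Pinf (tail g)) (pos b j) ⌈ m /2⌉ , b) ≡ (window (Pinf g) (pos true (pos b j)) m , true)
  window-liftOdd b j = cong (_, true) (sym (trans (window-odd g (pos b j) m)
    (cong (λ x → weaveAtOdd m (neg x) (window (Pinf (tail g)) (pos b j) ⌈ m /2⌉)) (alt-pos (g 0) b j))))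

  LiftedFactor : Vec PM m × Bool → Set
  LiftedFactor x = Image liftEven (ParityFactor (Pinf (tail g)) ⌊ m /2⌋) x
                 ⊎ Image liftOdd  (ParityFactor (Pinf (tail g)) ⌈ m /2⌉) x

  parityFactor-split : ∀ x → LiftedFactor x ⇔ ParityFactor (Pinf g) m x
  parityFactor-split x = mk⇔
    (λ { (inj₁ ((_ , b) , (j , refl) , refl)) → pos b j , cong proj₁ (sym (window-liftEven b j))
       ; (inj₂ ((_ , b) , (j , refl) , refl)) → pos b j , cong proj₁ (sym (window-liftOdd b j)) })
    (from′ x)
    where
    from′ : ∀ x → ParityFactor (Pinf g) m x → LiftedFactor x
    from′ (_ , false) (j , refl) with parity j
    ... | at b j′ = inj₁ ((_ , b) , (j′ , refl) , window-liftEven b j′)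
    from′ (_ , true)  (j , refl) with parity j
    ... | at b j′ = inj₂ ((_ , b) , (j′ , refl) , window-liftOdd b j′)

parityFactorCount-step : ∀ g k → let m = suc (suc k) in
  Count (ParityFactor (Pinf (tail g)) ⌊ m /2⌋) (4 * ⌊ m /2⌋) →
  Count (ParityFactor (Pinf (tail g)) ⌈ m /2⌉) (4 * ⌈ m /2⌉) →
  Count (ParityFactor (Pinf g) m) (4 * m)
parityFactorCount-step g k evens odds =
  subst (Count _) count-split
    (Count-cong parityFactor-split
      (Count-⊎ (λ { (_ , _ , refl) (_ , _ , ()) })
        (Count-image (λ _ _ → liftEven-injective) evens)
        (Count-image (λ _ _ → liftOdd-injective) odds)))
  where
  m = suc (suc k)
  open ParityStep g m
  liftEven-injective : ∀ {x y} → liftEven x ≡ liftEven y → x ≡ y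
  liftEven-injective e =
    cong₂ _,_ (weaveAtEven-injective m e₁) (alt-pos-injective (g 0) (∷-injectiveˡ e₁))
    where e₁ = cong proj₁ e
  liftOdd-injective : ∀ {x y} → liftOdd x ≡ liftOdd y → x ≡ y
  liftOdd-injective {_ ∷ _ , _} {_ ∷ _ , _} e =
    cong₂ _,_ (weaveAtOdd-injective m e₁)
              (alt-pos-injective (g 0) (neg-injective (∷-injectiveˡ (∷-injectiveʳ e₁))))
    where e₁ = cong proj₁ e
  count-split : 4 * ⌊ m /2⌋ + 4 * ⌈ m /2⌉ ≡ 4 * m
  count-split = trans (sym (*-distribˡ-+ 4 ⌊ m /2⌋ ⌈ m /2⌉)) (cong (4 *_) (⌊n/2⌋+⌈n/2⌉≡n m))

parityFactorCount : ∀ m → 1 ≤ m → ∀ g → Count (ParityFactor (Pinf g) m) (4 * m)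
parityFactorCount = <-rec _ λ where
  (suc zero)    _   _ g → parityFactorCount-1 g
  (suc (suc k)) rec _ g → parityFactorCount-step g k
    (rec (⌊n/2⌋<n (suc k)) (s≤s z≤n) (tail g))
    (rec (⌈n/2⌉<n k) (s≤s z≤n) (tail g))

double-+-double : ∀ j r → (j + j) + (r + r) ≡ (r + j) + (r + j)
double-+-double = solve-∀

-- The entries at even offsets of the first window alternate, so P_{tail g} would contain x y x y.
parity-sync : ∀ g m j j′ → 7 ≤ m → window (Pinf g) (j + j) m ≢ window (Pinf g) (suc (j′ + j′)) m
parity-sync g m j j′ 7≤m e = Pinf-no-period-2 (tail g) j′
  (trans (agree 2 (s≤s (s≤s z≤n))) (trans (neg-involutive (alt (g 0) j)) (sym (agree 0 z≤n))))
  (trans (agree 3 ≤-refl) (trans (neg-involutive (alt (g 0) (suc j))) (sym (agree 1 (s≤s z≤n)))))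
  where
  agree : ∀ r → r ≤ 3 → Pinf (tail g) (r + j′) ≡ alt (g 0) (r + j)
  agree r r≤3 = begin
    Pinf (tail g) (r + j′)                 ≡⟨ sym (Pinf-odd g (r + j′)) ⟩
    Pinf g (suc ((r + j′) + (r + j′)))     ≡⟨ cong (Pinf g ∘ suc) (sym (double-+-double j′ r)) ⟩
    Pinf g (suc (j′ + j′) + (r + r))       ≡⟨ sym (window-agree (Pinf g) (j + j) _ m (r + r) e r+r<m) ⟩
    Pinf g ((j + j) + (r + r))             ≡⟨ cong (Pinf g) (double-+-double j r) ⟩
    Pinf g ((r + j) + (r + j))             ≡⟨ Pinf-even g (r + j) ⟩
    alt (g 0) (r + j)                      ∎
    where
    open ≡-Reasoning
    r+r<m : r + r < m
    r+r<m = ≤-trans (s≤s (+-mono-≤ r≤3 r≤3)) 7≤m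

paperfolding-factorCount : ∀ g m → 7 ≤ m → FactorCount (Pinf g) m (4 * m)
paperfolding-factorCount g m 7≤m =
  Count-cong factor⇔ (Count-image parity-determined (parityFactorCount m (≤-trans (s≤s z≤n) 7≤m) g))
  where
  parity-determined : ∀ {x y} → ParityFactor (Pinf g) m x → ParityFactor (Pinf g) m y → proj₁ x ≡ proj₁ y → x ≡ y
  parity-determined {_ , false} {_ , false} _ _ refl = refl
  parity-determined {_ , true}  {_ , true}  _ _ refl = refl
  parity-determined {_ , false} {_ , true}  (j , e) (j′ , e′) refl = ⊥-elim (parity-sync g m j j′ 7≤m (trans e (sym e′)))
  parity-determined {_ , true}  {_ , false} (j , e) (j′ , e′) refl = ⊥-elim (parity-sync g m j′ j 7≤m (trans e′ (sym e)))
  factor⇔ : ∀ w → Image proj₁ (ParityFactor (Pinf g) m) w ⇔ IsFactor (Pinf g) w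
  factor⇔ w = ⇔.trans (mk⇔ (λ { ((_ , b) , (j , e) , refl) → pos b j , e })
                            (λ { (i , e) → occurrence i e }))
                      (⇔.sym (IsFactor⇔window (Pinf g) w))
    where
    occurrence : ∀ i → window (Pinf g) i m ≡ w → Image proj₁ (ParityFactor (Pinf g) m) w
    occurrence i e with parity i
    ... | at b j = (w , b) , (j , e) , refl

PrefixExtends : ℕ → Set
PrefixExtends m = ∀ g y → ∃ λ j → window (Pinf g) (pos true j) (suc m) ≡ y ∷ window (Pinf g) 0 m

prefix-extends : ∀ m → PrefixExtends m
prefix-extends = <-rec PrefixExtends step
  where
  step : ∀ m → (∀ {m′} → m′ < m → PrefixExtends m′) → PrefixExtends m
  step zero    _   g y with Pinf-hits g true y
  ... | j , e = j , cong (_∷ []) e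
  step (suc m) rec g y with rec (s≤s (⌈n/2⌉≤n m)) (tail g) y
  ... | j , e = J , (begin
    window (Pinf g) (suc (J + J)) (suc (suc m))
      ≡⟨ window-odd g J (suc (suc m)) ⟩
    weaveAtOdd (suc (suc m)) (alt (g 0) (suc J)) (window (Pinf (tail g)) J (suc ⌈ m /2⌉))
      ≡⟨ cong₂ (weaveAtOdd (suc (suc m))) (trans (neg-involutive _) (alt-double (g 0) j)) e ⟩
    y ∷ weaveAtEven (suc m) (g 0) (window (Pinf (tail g)) 0 ⌈ m /2⌉)
      ≡⟨ cong (y ∷_) (sym (window-even g 0 (suc m))) ⟩
    y ∷ window (Pinf g) 0 (suc m) ∎)
    where
    open ≡-Reasoning
    J = pos true j

StrictlyIncreasing : (ℕ → ℕ) → Set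
StrictlyIncreasing b = ∀ k → b k < b (suc k)

module _ {b : ℕ → ℕ} (b-inc : StrictlyIncreasing b) where

  increasing-mono : ∀ {k k′} → k ≤′ k′ → b k ≤ b k′
  increasing-mono ≤′-refl        = ≤-refl
  increasing-mono (≤′-step k≤k′) = ≤-trans (increasing-mono k≤k′) (<⇒≤ (b-inc _))

  increasing-cancel-< : ∀ {k k′} → b k < b k′ → k < k′
  increasing-cancel-< {k} {k′} bk<bk′ with k <? k′
  ... | yes k<k′ = k<k′
  ... | no  k≮k′ = ⊥-elim (<⇒≱ bk<bk′ (increasing-mono (≤⇒≤′ (≮⇒≥ k≮k′))))

  increasing-≥id : ∀ k → k ≤ b k
  increasing-≥id zero    = z≤n
  increasing-≥id (suc k) = ≤-<-trans (increasing-≥id k) (b-inc k)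

range-⊆⇒≤ : ∀ {b e} → StrictlyIncreasing b → StrictlyIncreasing e →
  (∀ k → ∃ λ m → b m ≡ e k) → ∀ k → b k ≤ e k
range-⊆⇒≤ {b} {e} b-inc e-inc covered k = begin
  b k                ≤⟨ increasing-mono b-inc (≤⇒≤′ (increasing-≥id index-inc k)) ⟩
  b (index k)        ≡⟨ proj₂ (covered k) ⟩
  e k                ∎
  where
  open ≤-Reasoning
  index : ℕ → ℕ
  index k = proj₁ (covered k)
  index-inc : StrictlyIncreasing index
  index-inc k = increasing-cancel-< b-inc
    (subst₂ _<_ (sym (proj₂ (covered k))) (sym (proj₂ (covered (suc k)))) (e-inc k))

same-range⇒≗ : ∀ {b e} → StrictlyIncreasing b → StrictlyIncreasing e →
  (∀ k → ∃ λ m → b m ≡ e k) → (∀ k → ∃ λ m → e m ≡ b k) → ∀ k → b k ≡ e k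
same-range⇒≗ b-inc e-inc e⊆b b⊆e k =
  ≤-antisym (range-⊆⇒≤ b-inc e-inc e⊆b k) (range-⊆⇒≤ e-inc b-inc b⊆e k)

gap : PM → PM → ℕ
gap m1 m1 = 2
gap m1 p1 = 3
gap p1 m1 = 1
gap p1 p1 = 2

pos-suc∸pos : ∀ x y k → pos (isP1 y) (suc k) ∸ pos (isP1 x) k ≡ gap x y
pos-suc∸pos m1 m1 k rewrite +-suc k k = m+n∸n≡m (gap m1 m1) (pos false k)
pos-suc∸pos m1 p1 k rewrite +-suc k k = m+n∸n≡m (gap m1 p1) (pos false k)
pos-suc∸pos p1 m1 k rewrite +-suc k k = m+n∸n≡m (gap p1 m1) (pos true k)
pos-suc∸pos p1 p1 k rewrite +-suc k k = m+n∸n≡m (gap p1 p1) (pos true k)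

suc-pos-zero : ∀ y → suc (pos (isP1 y) 0) ≡ gap p1 y
suc-pos-zero m1 = refl
suc-pos-zero p1 = refl

gap-injectiveʳ : ∀ {x y y′} → gap x y ≡ gap x y′ → y ≡ y′
gap-injectiveʳ {m1} {m1} {m1} _ = refl
gap-injectiveʳ {m1} {p1} {p1} _ = refl
gap-injectiveʳ {p1} {m1} {m1} _ = refl
gap-injectiveʳ {p1} {p1} {p1} _ = refl
gap-injectiveʳ {m1} {m1} {p1} ()
gap-injectiveʳ {m1} {p1} {m1} ()
gap-injectiveʳ {p1} {m1} {p1} ()
gap-injectiveʳ {p1} {p1} {m1} ()

gap-cross : ∀ {x x′ y y′} → x ≢ x′ → gap x y ≡ gap x′ y′ → y ≡ x × y′ ≡ x′
gap-cross {m1} {m1} x≢x′ _ = ⊥-elim (x≢x′ refl)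
gap-cross {p1} {p1} x≢x′ _ = ⊥-elim (x≢x′ refl)
gap-cross {p1} {m1} {p1} {m1} _ _ = refl , refl
gap-cross {m1} {p1} {m1} {p1} _ _ = refl , refl
gap-cross {p1} {m1} {p1} {p1} _ ()
gap-cross {p1} {m1} {m1} {m1} _ ()
gap-cross {p1} {m1} {m1} {p1} _ ()
gap-cross {m1} {p1} {m1} {m1} _ ()
gap-cross {m1} {p1} {p1} {p1} _ ()
gap-cross {m1} {p1} {p1} {m1} _ ()

code : ∀ {n} → Vec PM (suc n) → Vec ℕ n
code (x ∷ [])    = []
code (x ∷ y ∷ v) = gap x y ∷ code (y ∷ v)

code-injective-tail : ∀ {n x x′} {v v′ : Vec PM n} → x ≡ x′ → code (x ∷ v) ≡ code (x′ ∷ v′) → v ≡ v′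
code-injective-tail {v = []}    {[]}    refl _ = refl
code-injective-tail {v = y ∷ v} {_ ∷ _} refl e with gap-injectiveʳ (∷-injectiveˡ e)
... | refl = cong (y ∷_) (code-injective-tail refl (∷-injectiveʳ e))

code-heads-differ : ∀ {n x y z u x′ y′ z′ u′} {v v′ : Vec PM n} → x ≢ x′ →
  code (x ∷ y ∷ z ∷ u ∷ v) ≡ code (x′ ∷ y′ ∷ z′ ∷ u′ ∷ v′) → z ≡ x × u ≡ y
code-heads-differ x≢x′ e with gap-cross x≢x′ (∷-injectiveˡ e)
... | refl , refl with gap-cross x≢x′ (∷-injectiveˡ (∷-injectiveʳ e))
... | refl , refl with gap-cross x≢x′ (∷-injectiveˡ (∷-injectiveʳ (∷-injectiveʳ e)))
... | refl , refl = refl , refl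

code-window-injective : ∀ g n i i′ →
  code (window (Pinf g) i (4 + n)) ≡ code (window (Pinf g) i′ (4 + n)) →
  window (Pinf g) i (4 + n) ≡ window (Pinf g) i′ (4 + n)
code-window-injective g n i i′ e with Pinf g i ≟ₚ Pinf g i′
... | yes same = cong₂ _∷_ same (code-injective-tail same e)
... | no  differ with code-heads-differ differ e
... | period₁ , period₂ = ⊥-elim (Pinf-no-period-2 g i period₁ period₂)

module CodedSequence (g : Seq PM) (R : Seq ℕ)
  (R-zero : R 0 ≡ gap p1 (Pinf g 0)) (R-suc : ∀ k → R (suc k) ≡ gap (Pinf g k) (Pinf g (suc k))) where

  window-R-suc : ∀ i n → window R (suc i) n ≡ code (window (Pinf g) i (suc n))
  window-R-suc i zero    = refl
  window-R-suc i (suc n) = cong₂ _∷_ (R-suc i) (window-R-suc (suc i) n)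

  window-R-zero : ∀ n → window R 0 n ≡ code (p1 ∷ window (Pinf g) 0 n)
  window-R-zero zero    = refl
  window-R-zero (suc n) = cong₂ _∷_ R-zero (window-R-suc 0 n)

  factors-R : ∀ {n} (w : Vec ℕ n) → Image code (λ v → IsFactor (Pinf g) v) w ⇔ IsFactor R w
  factors-R {n} w = ⇔.trans (mk⇔ to′ from′) (⇔.sym (IsFactor⇔window R w))
    where
    to′ : Image code (λ v → IsFactor (Pinf g) v) w → ∃ λ i → window R i n ≡ w
    to′ (v , v-factor , refl) with to (IsFactor⇔window (Pinf g) v) v-factor
    ... | i , refl = suc i , window-R-suc i n
    from′ : (∃ λ i → window R i n ≡ w) → Image code (λ v → IsFactor (Pinf g) v) w
    from′ (zero , refl) with prefix-extends n g p1
    ... | j , e = p1 ∷ window (Pinf g) 0 n , from (IsFactor⇔window (Pinf g) _) (pos true j , e) , sym (window-R-zero n)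
    from′ (suc i , refl) =
      window (Pinf g) i (suc n) , from (IsFactor⇔window (Pinf g) _) (i , refl) , sym (window-R-suc i n)

  codedFactorCount : ∀ n → 6 ≤ n → FactorCount R n (4 * n + 4)
  codedFactorCount n@(suc (suc (suc n′))) 6≤n =
    subst (FactorCount R n) (trans (*-suc 4 n) (+-comm 4 (4 * n)))
      (Count-cong factors-R (Count-image code-injective (paperfolding-factorCount g (suc n) (s≤s 6≤n))))
    where
    code-injective : ∀ {v v′ : Vec PM (suc n)} → IsFactor (Pinf g) v → IsFactor (Pinf g) v′ → code v ≡ code v′ → v ≡ v′
    code-injective {v} {v′} v-factor v′-factor
      with to (IsFactor⇔window (Pinf g) v) v-factor | to (IsFactor⇔window (Pinf g) v′) v′-factor
    ... | i , refl | i′ , refl = code-window-injective g n′ i i′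
  codedFactorCount (suc zero)       (s≤s ())
  codedFactorCount (suc (suc zero)) (s≤s (s≤s ()))

module RunBoundaries (f : Seq PM) where

  endFolds : Seq PM
  endFolds zero    = f 0 · f 1
  endFolds (suc k) = neg (f 0) · f (suc (suc k))

  endMarks : Seq PM
  endMarks = Pinf endFolds

  endMarks-≡ : ∀ j → endMarks j ≡ alt (f 0) j · Pinf (tail f) j
  endMarks-≡ j with parity j
  ... | at false q = begin
    Pinf endFolds (q + q)                    ≡⟨ Pinf-even endFolds q ⟩
    alt (f 0 · f 1) q                        ≡⟨ sym (·-alt (f 0) (f 1) q) ⟩
    f 0 · alt (f 1) q                        ≡⟨ sym (cong₂ _·_ (alt-double (f 0) q) (Pinf-even (tail f) q)) ⟩
    alt (f 0) (q + q) · Pinf (tail f) (q + q) ∎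
    where open ≡-Reasoning
  ... | at true q = begin
    Pinf endFolds (suc (q + q))              ≡⟨ Pinf-odd endFolds q ⟩
    Pinf (λ k → neg (f 0) · f (suc (suc k))) q ≡⟨ Pinf-scale (neg (f 0)) (tail (tail f)) q ⟩
    neg (f 0) · Pinf (tail (tail f)) q       ≡⟨ sym (cong₂ _·_ (cong neg (alt-double (f 0) q)) (Pinf-odd (tail f) q)) ⟩
    alt (f 0) (suc (q + q)) · Pinf (tail f) (suc (q + q)) ∎
    where open ≡-Reasoning

  runEnd : ℕ → ℕ
  runEnd k = pos (isP1 (endMarks k)) k

  runEnd-increasing : StrictlyIncreasing runEnd
  runEnd-increasing k = pos<pos-suc (isP1 (endMarks k)) (isP1 (endMarks (suc k))) k

  boundary⇔endMark : ∀ b j → (Pinf f (pos b j) ≢ Pinf f (suc (pos b j))) ⇔ (isP1 (endMarks j) ≡ b)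
  boundary⇔endMark false j rewrite Pinf-even f j | Pinf-odd f j | endMarks-≡ j =
    ≢⇔isP1-·≡false (alt (f 0) j) (Pinf (tail f) j)
  boundary⇔endMark true j rewrite Pinf-odd f j | Pinf-even-suc f j | endMarks-≡ j =
    ≢neg⇔isP1-·≡true (alt (f 0) j) (Pinf (tail f) j)

  runEnd⇔endMark : ∀ b j → (∃ λ k → runEnd k ≡ pos b j) ⇔ (isP1 (endMarks j) ≡ b)
  runEnd⇔endMark b j = mk⇔
    (λ (k , e) → case pos-injective {isP1 (endMarks k)} {b} {k} {j} e of λ { (refl , refl) → refl })
    (λ e → j , cong (λ b → pos b j) e)

  runEnd-boundaries : ∀ i → (Pinf f i ≢ Pinf f (suc i)) ⇔ (∃ λ k → runEnd k ≡ i)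
  runEnd-boundaries i with parity i
  ... | at b j = ⇔.trans (boundary⇔endMark b j) (⇔.sym (runEnd⇔endMark b j))

  runLengths : Seq ℕ
  runLengths zero    = suc (runEnd 0)
  runLengths (suc k) = runEnd (suc k) ∸ runEnd k

  runLengths-isRunLengthSeq : IsRunLengthSeq (Pinf f) runLengths
  runLengths-isRunLengthSeq = runEnd , runEnd-increasing , runEnd-boundaries , refl , λ _ → refl

  runLength-gaps : ∀ {R} → IsRunLengthSeq (Pinf f) R →
    R 0 ≡ gap p1 (endMarks 0) × (∀ k → R (suc k) ≡ gap (endMarks k) (endMarks (suc k)))
  runLength-gaps (b , b-inc , b-boundaries , R-zero , R-suc) =
    trans R-zero (trans (cong suc (b≗runEnd 0)) (suc-pos-zero (endMarks 0))) ,
    λ k → trans (R-suc k) (trans (cong₂ _∸_ (b≗runEnd (suc k)) (b≗runEnd k))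
                                 (pos-suc∸pos (endMarks k) (endMarks (suc k)) k))
    where
    b≗runEnd : ∀ k → b k ≡ runEnd k
    b≗runEnd = same-range⇒≗ b-inc runEnd-increasing
      (λ k → to (b-boundaries _) (from (runEnd-boundaries _) (k , refl)))
      (λ k → to (runEnd-boundaries _) (from (b-boundaries _) (k , refl)))

theorem9 : (f : Seq PM) →
    Σ (Seq ℕ) (IsRunLengthSeq (Pinf f)) ×
    (∀ (R : Seq ℕ) → IsRunLengthSeq (Pinf f) R →
      ∀ (n : ℕ) → 6 ≤ n → FactorCount R n (4 * n + 4))
theorem9 f = (runLengths , runLengths-isRunLengthSeq) , counts
  where
  open RunBoundaries f
  counts : ∀ R → IsRunLengthSeq (Pinf f) R → ∀ n → 6 ≤ n → FactorCount R n (4 * n + 4)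
  counts R isRunLengthSeq with runLength-gaps {R} isRunLengthSeq
  ... | R-zero , R-suc = CodedSequence.codedFactorCount endFolds R R-zero R-suc
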